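{- Let $q$ be a prime power and let $v,d,k$ be integers with $d$ even, $2 \le d/2 \le k \le v/2$ and $k<d$. Let $C$ be a $(v,\#C,d;k)_q$ constant dimension code that contains a lifted MRD code. Then \[\#C \le q^{(v-k)(k-d/2+1)} + A_q(v-k,2(d-k);d/2).\]
   Context: $V=\mathbb{F}_q^v$. The subspace distance is $d_S(U,W)=\dim(U+W)-\dim(U\cap W)$. A $(v,M,d;k)_q$ constant dimension code is a set of $M$ $k$-dimensional subspaces of $\mathbb{F}_q^v$ with pairwise subspace distance at least $d$; $A_q(v,d;k)$ is the maximum cardinality of such a code. A lifted MRD code is $\{\operatorname{rowspan}(I_k\mid A): A\in\mathcal{M}\}$, where $\mathcal{M}\subseteq\mathbb{F}_q^{k\times(v-k)}$ is an $\mathbb{F}_q$-linear space of $q^{(v-k)(k-d/2+1)}$ matrices with $\mathrm{rk}(A-B)\ge d/2$ for all distinct $A,B\in\mathcal{M}$ (a maximum rank distance code), $I_k$ is the $k\times k$ identity and $(I_k\mid A)$ denotes horizontal concatenation. -}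

module Defs where

open import Data.Nat using (ℕ; zero; suc; _≤_; _<_; _^_; _∸_) renaming (_+_ to _+ℕ_; _*_ to _*ℕ_)
open import Data.Nat.Properties using (∸-monoˡ-<; ≰⇒>)
open import Data.Nat.Primality using (Prime)
open import Data.Fin using (Fin; zero; suc; toℕ; fromℕ<; _≟_)
open import Data.Fin.Properties using (toℕ<n)
open import Data.Product using (Σ; ∃; _×_; _,_)
open import Data.Sum using (inj₁; inj₂)
open import Relation.Nullary using (¬_; yes; no)
open import Relation.Binary.PropositionalEquality using (_≡_; _≢_)
open import Algebra.Structures using (IsCommutativeRing)
open import Algebra.Core using (Op₁; Op₂)
import Data.Vec.Functional as VF
import Data.Nat as ℕ
open import Function.Bundles using (_⇔_)

IsPrimePower : ℕ → Set
IsPrimePower q = Σ ℕ λ p → Σ ℕ λ e → Prime p × q ≡ p ^ suc e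

record Field : Set₁ where
  infixl 7 _*_
  infixl 6 _+_
  field
    Carrier : Set
    _+_ _*_ : Op₂ Carrier
    -_ : Op₁ Carrier
    0# 1# : Carrier
    isCommutativeRing : IsCommutativeRing _≡_ _+_ _*_ -_ 0# 1#
    0≢1 : 0# ≢ 1#
    inverse : ∀ x → x ≢ 0# → ∃ λ y → x * y ≡ 1#

module _ (F : Field) where
  open Field F

  FVec : ℕ → Set
  FVec n = Fin n → Carrier

  Mat : ℕ → ℕ → Set
  Mat m n = Fin m → FVec n

  _≈V_ : ∀ {n} → FVec n → FVec n → Set
  x ≈V y = ∀ j → x j ≡ y j

  _≈M_ : ∀ {m n} → Mat m n → Mat m n → Set
  A ≈M B = ∀ i j → A i j ≡ B i j

  ∑ : ∀ {m} → (Fin m → Carrier) → Carrier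
  ∑ {zero} f = 0#
  ∑ {suc m} f = f zero + ∑ (λ i → f (suc i))

  lincomb : ∀ {m n} → (Fin m → Carrier) → Mat m n → FVec n
  lincomb c G j = ∑ (λ i → c i * G i j)

  InSpan : ∀ {m n} → Mat m n → FVec n → Set
  InSpan G x = Σ (Fin _ → Carrier) λ c → x ≈V lincomb c G

  LinIndep : ∀ {m n} → Mat m n → Set
  LinIndep G = ∀ c → lincomb c G ≈V (λ _ → 0#) → ∀ i → c i ≡ 0#

  HasDim : ∀ {n} → (FVec n → Set) → ℕ → Set
  HasDim {n} P d = Σ (Mat d n) λ B → LinIndep B × (∀ x → P x ⇔ InSpan B x)

  HasRank : ∀ {m n} → Mat m n → ℕ → Set
  HasRank A r = HasDim (InSpan A) r

  SubspaceDist : ∀ {a b n} → Mat a n → Mat b n → ℕ → Set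
  SubspaceDist G H δ =
    Σ ℕ λ s → Σ ℕ λ t →
      HasDim (InSpan (G VF.++ H)) s ×
      HasDim (λ x → InSpan G x × InSpan H x) t ×
      s ≡ δ +ℕ t

  SameSpace : ∀ {a b n} → Mat a n → Mat b n → Set
  SameSpace G H = ∀ x → InSpan G x ⇔ InSpan H x

  -- A (v, M, d; k)_q constant dimension code: M k-dimensional subspaces
  -- (given by k×v generator matrices of full rank), pairwise distance ≥ d.
  IsCDC : (v d k M : ℕ) → (Fin M → Mat k v) → Set
  IsCDC v d k M C =
    (∀ i → LinIndep (C i)) ×
    (∀ i j → i ≢ j → ∀ δ → SubspaceDist (C i) (C j) δ → d ≤ δ)

  CDC : (v d k M : ℕ) → Set
  CDC v d k M = Σ (Fin M → Mat k v) (IsCDC v d k M)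

  IsMaxCDCSize : (v d k m : ℕ) → Set
  IsMaxCDCSize v d k m = CDC v d k m × (∀ M → CDC v d k M → M ≤ m)

  _⊕_ : ∀ {m n} → Mat m n → Mat m n → Mat m n
  (A ⊕ B) i j = A i j + B i j

  _⊖_ : ∀ {m n} → Mat m n → Mat m n → Mat m n
  (A ⊖ B) i j = A i j + (- B i j)

  _⊙_ : ∀ {m n} → Carrier → Mat m n → Mat m n
  (a ⊙ A) i j = a * A i j

  -- MRD code: an F-linear set of N matrices in F^{k×n} (listed without
  -- repetition) with rank distance ≥ δ between distinct members
  IsLinearRankCode : (k n δ N : ℕ) → (Fin N → Mat k n) → Set
  IsLinearRankCode k n δ N Ms =
    (∀ i j → i ≢ j → ¬ (Ms i ≈M Ms j)) ×
    (∀ i j → Σ (Fin N) λ l → Ms l ≈M (Ms i ⊕ Ms j)) ×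
    (∀ a i → Σ (Fin N) λ l → Ms l ≈M (a ⊙ Ms i)) ×
    (∀ i j → i ≢ j → ∀ r → HasRank (Ms i ⊖ Ms j) r → δ ≤ r)

  -- the k×v matrix (I_k | A), for A a k×(v-k) matrix
  liftMat : ∀ {k v} → Mat k (v ∸ k) → Mat k v
  liftMat {k} {v} A r c with toℕ c ℕ.<? k
  ... | yes c<k with fromℕ< c<k ≟ r
  ...   | yes _ = 1#
  ...   | no _  = 0#
  liftMat {k} {v} A r c | no c≮k =
    A r (fromℕ< (∸-monoˡ-< (toℕ<n c) (≤-pred' (≰⇒> c≮k))))
    where
      ≤-pred' : ∀ {a b} → suc b ℕ.≤ suc a → b ℕ.≤ a
      ≤-pred' (ℕ.s≤s p) = p

  -- C contains a lifted MRD code: there is a linear MRD code M ⊆ F^{k×(v-k)}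
  -- with q^{(v-k)(k-δ+1)} elements and minimum rank distance δ, such that
  -- each rowspan(I_k | A), A ∈ M, is a member of C.
  ContainsLiftedMRD : (q v δ k M : ℕ) → (Fin M → Mat k v) → Set
  ContainsLiftedMRD q v δ k M C =
    Σ (Fin (q ^ ((v ∸ k) *ℕ ((k ∸ δ) +ℕ 1))) → Mat k (v ∸ k)) λ Ms →
      IsLinearRankCode k (v ∸ k) δ _ Ms ×
      (∀ i → Σ (Fin M) λ j → SameSpace (liftMat (Ms i)) (C j))

module Submission where

-- Let S ⊆ F^v consist of the vectors vanishing on the first k coordinates, and call a codeword
-- covered if it is one of the lifted MRD codewords rowspan (I_k ∣ A).  If an uncovered codeword U
-- had dim (U ∩ S) < δ = d/2, it would contain k - δ + 1 independent vectors spanning a space T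
-- with T ∩ S = 0.  Counting with the rank distance of the MRD code shows that T lies in a lifted
-- codeword W ≠ U; then dim (U ∩ W) > k - δ, contradicting d_S(U, W) ≥ d.  So every uncovered
-- codeword contains a δ-dimensional subspace of S, and the projections of these to the last
-- v - k coordinates form a (v - k, ·, 2(d - k); d/2)_q code, since two of them meet in dimension
-- at most k - d/2.

open import Defs
open import Algebra.Bundles using (CommutativeRing)
open import Algebra.Structures using (IsCommutativeRing)
open import Data.Empty using (⊥-elim)
open import Data.Fin
  using (Fin; zero; suc; toℕ; fromℕ<; inject≤; _↑ˡ_; _↑ʳ_; splitAt; join; cast; punchOut; funToFin; finToFun; combine)
import Data.Fin.Properties as Fin
open import Data.Nat using (ℕ; zero; suc; _≤_; _<_; _≰_; _^_; _∸_; _/_; z≤n; s≤s)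
  renaming (_+_ to _+ℕ_; _*_ to _*ℕ_)
import Data.Nat.Properties as ℕ
open import Data.Nat.DivMod using (m*[n/m]≡n)
open import Data.Nat.Divisibility using (_∣_)
open import Data.Nat.Tactic.RingSolver using (solve-∀)
open import Data.Product using (Σ; ∃; _×_; _,_; proj₁; proj₂; map; map₂)
open import Data.Sum using (_⊎_; inj₁; inj₂; [_,_]; [_,_]′)
open import Data.Vec.Functional using ([]; _∷_; _++_)
open import Data.Vec.Functional.Properties using (lookup-++ˡ; lookup-++ʳ)
open import Function using (_∘_; id; _↔_; Inverse; Injection; _⇔_; mk⇔; Equivalence)
open import Function.Properties.Inverse using (↔⇒↣)
open import Level using (0ℓ)
open import Relation.Binary.PropositionalEquality
open import Relation.Nullary using (¬_; ¬?; Dec; yes; no)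
open import Relation.Nullary.Decidable using (via-injection)

module Arithmetic where
  open ℕ.≤-Reasoning

  m+n≡k⇒k∸δ+1≤n : ∀ {m n k δ} → m +ℕ n ≡ k → m < δ → δ ≤ k → k ∸ δ +ℕ 1 ≤ n
  m+n≡k⇒k∸δ+1≤n {m} {n} {_} {δ} refl m<δ δ≤k = begin
    m +ℕ n ∸ δ +ℕ 1 ≡⟨ ℕ.+-comm (m +ℕ n ∸ δ) 1 ⟩
    suc (m +ℕ n ∸ δ) ≤⟨ ℕ.∸-monoʳ-< m<δ δ≤k ⟩
    m +ℕ n ∸ m      ≡⟨ ℕ.m+n∸m≡n m n ⟩
    n               ∎

  δ+[k∸δ+1]≰k : ∀ {δ k} → δ ≤ k → δ +ℕ (k ∸ δ +ℕ 1) ≰ k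
  δ+[k∸δ+1]≰k {δ} {k} δ≤k le = ℕ.n≮n k (subst (_≤ k) δ+[k∸δ+1]≡1+k le)
    where
    δ+[k∸δ+1]≡1+k : δ +ℕ (k ∸ δ +ℕ 1) ≡ suc k
    δ+[k∸δ+1]≡1+k = begin-equality
      δ +ℕ (k ∸ δ +ℕ 1) ≡⟨ ℕ.+-assoc δ (k ∸ δ) 1 ⟨
      δ +ℕ (k ∸ δ) +ℕ 1 ≡⟨ cong (_+ℕ 1) (ℕ.m+[n∸m]≡n δ≤k) ⟩
      k +ℕ 1            ≡⟨ ℕ.+-comm k 1 ⟩
      suc k             ∎

  distance≥2δ⇒δ+t≤k : ∀ {ρ t k δ} → ρ +ℕ 2 *ℕ t ≡ k +ℕ k → 2 *ℕ δ ≤ ρ → δ +ℕ t ≤ k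
  distance≥2δ⇒δ+t≤k {ρ} {t} {k} {δ} ρ+2t≡2k 2δ≤ρ = ℕ.*-cancelˡ-≤ 2 (begin
    2 *ℕ (δ +ℕ t)      ≡⟨ ℕ.*-distribˡ-+ 2 δ t ⟩
    2 *ℕ δ +ℕ 2 *ℕ t   ≤⟨ ℕ.+-monoˡ-≤ (2 *ℕ t) 2δ≤ρ ⟩
    ρ +ℕ 2 *ℕ t        ≡⟨ ρ+2t≡2k ⟩
    k +ℕ k             ≡⟨ double k ⟨
    2 *ℕ k             ∎)
    where
    double : ∀ x → 2 *ℕ x ≡ x +ℕ x
    double = solve-∀

  δ+t≤k⇒2[2δ∸k]≤ρ : ∀ {ρ t k δ} → ρ +ℕ 2 *ℕ t ≡ δ +ℕ δ → δ +ℕ t ≤ k → 2 *ℕ (2 *ℕ δ ∸ k) ≤ ρ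
  δ+t≤k⇒2[2δ∸k]≤ρ {ρ} {t} {k} {δ} ρ+2t≡2δ δ+t≤k = begin
    2 *ℕ (2 *ℕ δ ∸ k)         ≡⟨ ℕ.*-distribˡ-∸ 2 (2 *ℕ δ) k ⟩
    2 *ℕ (2 *ℕ δ) ∸ 2 *ℕ k    ≤⟨ ℕ.m≤n+o⇒m∸n≤o (2 *ℕ (2 *ℕ δ)) (2 *ℕ k) 4δ≤2k+ρ ⟩
    ρ                         ∎
    where
    quadruple : ∀ δ → 2 *ℕ (2 *ℕ δ) ≡ 2 *ℕ δ +ℕ (δ +ℕ δ)
    quadruple = solve-∀
    regroup : ∀ δ ρ t → 2 *ℕ δ +ℕ (ρ +ℕ 2 *ℕ t) ≡ 2 *ℕ (δ +ℕ t) +ℕ ρ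
    regroup = solve-∀
    4δ≤2k+ρ : 2 *ℕ (2 *ℕ δ) ≤ 2 *ℕ k +ℕ ρ
    4δ≤2k+ρ = begin
      2 *ℕ (2 *ℕ δ)            ≡⟨ quadruple δ ⟩
      2 *ℕ δ +ℕ (δ +ℕ δ)       ≡⟨ cong (2 *ℕ δ +ℕ_) ρ+2t≡2δ ⟨
      2 *ℕ δ +ℕ (ρ +ℕ 2 *ℕ t)  ≡⟨ regroup δ ρ t ⟩
      2 *ℕ (δ +ℕ t) +ℕ ρ       ≤⟨ ℕ.+-monoˡ-≤ ρ (ℕ.*-monoʳ-≤ 2 δ+t≤k) ⟩
      2 *ℕ k +ℕ ρ              ∎

module Counting where

  injective⇒surjective : ∀ {N} {φ : Fin N → Fin N} → (∀ {x y} → φ x ≡ φ y → x ≡ y) →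
                         ∀ y → ∃ λ x → φ x ≡ y
  injective⇒surjective {suc N} {φ} φ-injective y with Fin.any? (λ x → φ x Fin.≟ y)
  ... | yes hit = hit
  ... | no ∄x = ⊥-elim (ℕ.1+n≰n (Fin.injective⇒≤ ψ-injective))
    where
    ψ : Fin (suc N) → Fin N
    ψ x = punchOut (λ y≡φx → ∄x (x , sym y≡φx))
    ψ-injective : ∀ {x x′} → ψ x ≡ ψ x′ → x ≡ x′
    ψ-injective {x} {x′} =
      φ-injective ∘ Fin.punchOut-injective {i = y} (λ y≡φx → ∄x (x , sym y≡φx))
                                                   (λ y≡φx′ → ∄x (x′ , sym y≡φx′))

  cast-injective : ∀ {m n} .(m≡n : m ≡ n) {i j : Fin m} → cast m≡n i ≡ cast m≡n j → i ≡ j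
  cast-injective m≡n {i} {j} e =
    Fin.toℕ-injective (trans (sym (Fin.toℕ-cast m≡n i)) (trans (cong toℕ e) (Fin.toℕ-cast m≡n j)))

  record Enumeration {M} (P : Fin M → Set) : Set where
    field
      size           : ℕ
      elem           : Fin size → Fin M
      elem-injective : ∀ {l l′} → elem l ≡ elem l′ → l ≡ l′
      elem-∈         : ∀ l → P (elem l)
      elem-onto      : ∀ j → P j → ∃ λ l → elem l ≡ j

  open Enumeration

  enumerate : ∀ {M} {P : Fin M → Set} → (∀ j → Dec (P j)) → Enumeration P
  enumerate {zero} P? .size = 0
  enumerate {zero} P? .elem ()
  enumerate {zero} P? .elem-injective {()}
  enumerate {zero} P? .elem-∈ ()
  enumerate {zero} P? .elem-onto ()
  enumerate {suc M} P? with enumerate (P? ∘ suc) | P? zero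
  ... | E | no ¬P₀ = record
    { size           = size E
    ; elem           = suc ∘ elem E
    ; elem-injective = elem-injective E ∘ Fin.suc-injective
    ; elem-∈         = elem-∈ E
    ; elem-onto      = λ { zero P₀ → ⊥-elim (¬P₀ P₀) ; (suc j) Pj → map₂ (cong suc) (elem-onto E j Pj) }
    }
  ... | E | yes P₀ = record
    { size           = suc (size E)
    ; elem           = zero ∷ suc ∘ elem E
    ; elem-injective = λ { {zero} {zero} _ → refl
                         ; {suc l} {suc l′} e → cong suc (elem-injective E (Fin.suc-injective e)) }
    ; elem-∈         = λ { zero → P₀ ; (suc l) → elem-∈ E l }
    ; elem-onto      = λ { zero _ → zero , refl ; (suc j) Pj → map suc (cong suc) (elem-onto E j Pj) }
    }

  ≤-image+complement : ∀ {N M} (f : Fin N → Fin M) (E : Enumeration (λ j → ∀ i → f i ≢ j)) → M ≤ N +ℕ size E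
  ≤-image+complement {N} {M} f E = Fin.injective⇒≤ (classify-injective ∘ join-injective)
    where
    classify : Fin M → Fin N ⊎ Fin (size E)
    classify j with Fin.any? (λ i → f i Fin.≟ j)
    ... | yes (i , _) = inj₁ i
    ... | no ∄i = inj₂ (proj₁ (elem-onto E j (λ i fi≡j → ∄i (i , fi≡j))))
    classify-correct : ∀ j → [ f , elem E ]′ (classify j) ≡ j
    classify-correct j with Fin.any? (λ i → f i Fin.≟ j)
    ... | yes (_ , fi≡j) = fi≡j
    ... | no ∄i = proj₂ (elem-onto E j _)
    classify-injective : ∀ {j j′} → classify j ≡ classify j′ → j ≡ j′
    classify-injective {j} {j′} e =
      trans (sym (classify-correct j)) (trans (cong [ f , elem E ]′ e) (classify-correct j′))
    join-injective : ∀ {a b} → join N (size E) a ≡ join N (size E) b → a ≡ b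
    join-injective {a} {b} e =
      trans (sym (Fin.splitAt-join N (size E) a)) (trans (cong (splitAt N) e) (Fin.splitAt-join N (size E) b))

module LinearAlgebra (F : Field) where
  open Field F
  open IsCommutativeRing isCommutativeRing
    using (+-assoc; +-identityˡ; +-identityʳ; -‿inverseˡ; -‿inverseʳ;
           *-assoc; *-comm; *-identityˡ; zeroˡ; zeroʳ; distribˡ; distribʳ)

  commutativeRing : CommutativeRing 0ℓ 0ℓ
  commutativeRing = record { isCommutativeRing = isCommutativeRing }

  open import Algebra.Properties.Ring (CommutativeRing.ring commutativeRing)
    using (-‿distribˡ-*; -‿distribʳ-*; -0#≈0#; -‿+-comm; x∙y⁻¹≈ε⇒x≈y)
  import Algebra.Properties.Semiring.Sum (CommutativeRing.semiring commutativeRing) as Sum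

  open ≡-Reasoning

  ∑≡sum : ∀ {m} (f : Fin m → Carrier) → ∑ F f ≡ Sum.sum f
  ∑≡sum {zero}  f = refl
  ∑≡sum {suc m} f = cong (f zero +_) (∑≡sum (f ∘ suc))

  ∑-cong : ∀ {m} {f g : Fin m → Carrier} → (∀ i → f i ≡ g i) → ∑ F f ≡ ∑ F g
  ∑-cong {zero}  f≗g = refl
  ∑-cong {suc m} f≗g = cong₂ _+_ (f≗g zero) (∑-cong (f≗g ∘ suc))

  ∑-zero : ∀ {m} {f : Fin m → Carrier} → (∀ i → f i ≡ 0#) → ∑ F f ≡ 0#
  ∑-zero {zero}  f≗0 = refl
  ∑-zero {suc m} f≗0 = trans (cong₂ _+_ (f≗0 zero) (∑-zero (f≗0 ∘ suc))) (+-identityˡ 0#)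

  ∑-neg : ∀ {m} (f : Fin m → Carrier) → ∑ F (λ i → - f i) ≡ - ∑ F f
  ∑-neg {zero}  f = sym -0#≈0#
  ∑-neg {suc m} f = trans (cong (- f zero +_) (∑-neg (f ∘ suc))) (-‿+-comm (f zero) _)

  ∑-distrib-+ : ∀ {m} (f g : Fin m → Carrier) → ∑ F (λ i → f i + g i) ≡ ∑ F f + ∑ F g
  ∑-distrib-+ f g = begin
    ∑ F (λ i → f i + g i)      ≡⟨ ∑≡sum (λ i → f i + g i) ⟩
    Sum.sum (λ i → f i + g i)  ≡⟨ Sum.∑-distrib-+ f g ⟩
    Sum.sum f + Sum.sum g      ≡⟨ cong₂ _+_ (∑≡sum f) (∑≡sum g) ⟨
    ∑ F f + ∑ F g              ∎

  *-distribˡ-∑ : ∀ {m} a (f : Fin m → Carrier) → a * ∑ F f ≡ ∑ F (λ i → a * f i)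
  *-distribˡ-∑ a f = begin
    a * ∑ F f                ≡⟨ cong (a *_) (∑≡sum f) ⟩
    a * Sum.sum f            ≡⟨ Sum.*-distribˡ-sum a f ⟩
    Sum.sum (λ i → a * f i)  ≡⟨ ∑≡sum (λ i → a * f i) ⟨
    ∑ F (λ i → a * f i)      ∎

  *-distribʳ-∑ : ∀ {m} a (f : Fin m → Carrier) → ∑ F f * a ≡ ∑ F (λ i → f i * a)
  *-distribʳ-∑ a f = begin
    ∑ F f * a                ≡⟨ cong (_* a) (∑≡sum f) ⟩
    Sum.sum f * a            ≡⟨ Sum.*-distribʳ-sum a f ⟩
    Sum.sum (λ i → f i * a)  ≡⟨ ∑≡sum (λ i → f i * a) ⟨
    ∑ F (λ i → f i * a)      ∎

  ∑-comm : ∀ {m n} (f : Fin m → Fin n → Carrier) →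
           ∑ F (λ i → ∑ F (f i)) ≡ ∑ F (λ j → ∑ F (λ i → f i j))
  ∑-comm f = begin
    ∑ F (λ i → ∑ F (f i))                   ≡⟨ ∑≡sum (λ i → ∑ F (f i)) ⟩
    Sum.sum (λ i → ∑ F (f i))               ≡⟨ Sum.sum-cong-≗ (∑≡sum ∘ f) ⟩
    Sum.sum (λ i → Sum.sum (f i))           ≡⟨ Sum.∑-comm f ⟩
    Sum.sum (λ j → Sum.sum (λ i → f i j))   ≡⟨ Sum.sum-cong-≗ (λ j → ∑≡sum (λ i → f i j)) ⟨
    Sum.sum (λ j → ∑ F (λ i → f i j))       ≡⟨ ∑≡sum (λ j → ∑ F (λ i → f i j)) ⟨
    ∑ F (λ j → ∑ F (λ i → f i j))           ∎

  ∑-++ : ∀ {m n} (h : Fin (m +ℕ n) → Carrier) →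
         ∑ F h ≡ ∑ F (λ i → h (i ↑ˡ n)) + ∑ F (λ j → h (m ↑ʳ j))
  ∑-++ {zero}      h = sym (+-identityˡ _)
  ∑-++ {suc m} {n} h = trans (cong (h zero +_) (∑-++ {m} {n} (h ∘ suc))) (sym (+-assoc _ _ _))

  I : ∀ {n} → Mat F n n
  I zero    zero    = 1#
  I zero    (suc _) = 0#
  I (suc _) zero    = 0#
  I (suc i) (suc j) = I i j

  I-sym : ∀ {n} (i j : Fin n) → I i j ≡ I j i
  I-sym zero    zero    = refl
  I-sym zero    (suc j) = refl
  I-sym (suc i) zero    = refl
  I-sym (suc i) (suc j) = I-sym i j

  I-diag : ∀ {n} (i : Fin n) → I i i ≡ 1#
  I-diag zero    = refl
  I-diag (suc i) = I-diag i

  I-offdiag : ∀ {n} (i j : Fin n) → i ≢ j → I i j ≡ 0#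
  I-offdiag zero    zero    i≢j = ⊥-elim (i≢j refl)
  I-offdiag zero    (suc j) i≢j = refl
  I-offdiag (suc i) zero    i≢j = refl
  I-offdiag (suc i) (suc j) i≢j = I-offdiag i j (i≢j ∘ cong suc)

  ∑-I : ∀ {n} (i : Fin n) (f : Fin n → Carrier) → ∑ F (λ j → I i j * f j) ≡ f i
  ∑-I zero f = begin
    1# * f zero + ∑ F (λ j → 0# * f (suc j))  ≡⟨ cong₂ _+_ (*-identityˡ _) (∑-zero (λ j → zeroˡ (f (suc j)))) ⟩
    f zero + 0#                              ≡⟨ +-identityʳ _ ⟩
    f zero                                   ∎
  ∑-I (suc i) f = begin
    0# * f zero + ∑ F (λ j → I i j * f (suc j))  ≡⟨ cong₂ _+_ (zeroˡ _) (∑-I i (f ∘ suc)) ⟩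
    0# + f (suc i)                              ≡⟨ +-identityˡ _ ⟩
    f (suc i)                                   ∎

  infix 4 _≈_
  _≈_ : ∀ {n} → FVec F n → FVec F n → Set
  _≈_ = _≈V_ F

  ≈-refl : ∀ {n} {x : FVec F n} → x ≈ x
  ≈-refl j = refl

  ≈-sym : ∀ {n} {x y : FVec F n} → x ≈ y → y ≈ x
  ≈-sym x≈y j = sym (x≈y j)

  ≈-trans : ∀ {n} {x y z : FVec F n} → x ≈ y → y ≈ z → x ≈ z
  ≈-trans x≈y y≈z j = trans (x≈y j) (y≈z j)

  0ᵛ : ∀ {n} → FVec F n
  0ᵛ _ = 0#

  infixl 6 _+ᵛ_
  _+ᵛ_ : ∀ {n} → FVec F n → FVec F n → FVec F n
  (x +ᵛ y) j = x j + y j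

  -ᵛ_ : ∀ {n} → FVec F n → FVec F n
  (-ᵛ x) j = - x j

  lincomb-congˡ : ∀ {m n} {c c′ : Fin m → Carrier} (G : Mat F m n) →
                  (∀ i → c i ≡ c′ i) → lincomb F c G ≈ lincomb F c′ G
  lincomb-congˡ G c≗c′ j = ∑-cong (λ i → cong (_* G i j) (c≗c′ i))

  lincomb-congʳ : ∀ {m n} (c : Fin m → Carrier) {G H : Mat F m n} →
                  (∀ i → G i ≈ H i) → lincomb F c G ≈ lincomb F c H
  lincomb-congʳ c G≈H j = ∑-cong (λ i → cong (c i *_) (G≈H i j))

  lincomb-+ : ∀ {m n} (c c′ : Fin m → Carrier) (G : Mat F m n) →
              lincomb F (λ i → c i + c′ i) G ≈ lincomb F c G +ᵛ lincomb F c′ G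
  lincomb-+ c c′ G j =
    trans (∑-cong (λ i → distribʳ (G i j) (c i) (c′ i))) (∑-distrib-+ (λ i → c i * G i j) (λ i → c′ i * G i j))

  lincomb-* : ∀ {m n} a (c : Fin m → Carrier) (G : Mat F m n) j →
              lincomb F (λ i → a * c i) G j ≡ a * lincomb F c G j
  lincomb-* a c G j = trans (∑-cong (λ i → *-assoc a (c i) (G i j))) (sym (*-distribˡ-∑ a (λ i → c i * G i j)))

  lincomb-neg : ∀ {m n} (c : Fin m → Carrier) (G : Mat F m n) →
                lincomb F (λ i → - c i) G ≈ -ᵛ lincomb F c G
  lincomb-neg c G j = trans (∑-cong (λ i → sym (-‿distribˡ-* (c i) (G i j)))) (∑-neg (λ i → c i * G i j))

  lincomb-zeroˡ : ∀ {m n} (G : Mat F m n) → lincomb F (λ _ → 0#) G ≈ 0ᵛ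
  lincomb-zeroˡ G j = ∑-zero (λ i → zeroˡ (G i j))

  lincomb-zeroʳ : ∀ {m n} (c : Fin m → Carrier) {G : Mat F m n} → (∀ i → G i ≈ 0ᵛ) → lincomb F c G ≈ 0ᵛ
  lincomb-zeroʳ c G≈0 j = ∑-zero (λ i → trans (cong (c i *_) (G≈0 i j)) (zeroʳ _))

  lincomb-I : ∀ {m n} (i : Fin m) (G : Mat F m n) → lincomb F (I i) G ≈ G i
  lincomb-I i G j = ∑-I i (λ l → G l j)

  lincomb-of-I : ∀ {n} (x : FVec F n) → x ≈ lincomb F x I
  lincomb-of-I x j = sym (trans (∑-cong (λ i → trans (*-comm _ _) (cong (_* x i) (I-sym i j)))) (∑-I j x))

  I-indep : ∀ {n} → LinIndep F (I {n})
  I-indep c cI≈0 j = trans (lincomb-of-I c j) (cI≈0 j)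

  lincomb-assoc : ∀ {m p n} (c : Fin m → Carrier) (D : Mat F m p) (H : Mat F p n) →
                  lincomb F c (λ l → lincomb F (D l) H) ≈ lincomb F (lincomb F c D) H
  lincomb-assoc c D H j = begin
    ∑ F (λ l → c l * ∑ F (λ i → D l i * H i j))
      ≡⟨ ∑-cong (λ l → *-distribˡ-∑ (c l) (λ i → D l i * H i j)) ⟩
    ∑ F (λ l → ∑ F (λ i → c l * (D l i * H i j)))
      ≡⟨ ∑-comm (λ l i → c l * (D l i * H i j)) ⟩
    ∑ F (λ i → ∑ F (λ l → c l * (D l i * H i j)))
      ≡⟨ ∑-cong (λ i → ∑-cong (λ l → sym (*-assoc (c l) (D l i) (H i j)))) ⟩
    ∑ F (λ i → ∑ F (λ l → (c l * D l i) * H i j))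
      ≡⟨ ∑-cong (λ i → *-distribʳ-∑ (H i j) (λ l → c l * D l i)) ⟨
    ∑ F (λ i → ∑ F (λ l → c l * D l i) * H i j)    ∎

  lincomb-split : ∀ {m k n} (c : Fin (m +ℕ k) → Carrier) (G : Mat F m n) (H : Mat F k n) →
                  lincomb F c (G ++ H) ≈ lincomb F (c ∘ (_↑ˡ k)) G +ᵛ lincomb F (c ∘ (m ↑ʳ_)) H
  lincomb-split {m} {k} c G H j = trans (∑-++ {m} {k} _)
    (cong₂ _+_ (∑-cong (λ i → cong (λ r → c (i ↑ˡ k) * r j) (lookup-++ˡ G H i)))
               (∑-cong (λ i → cong (λ r → c (m ↑ʳ i) * r j) (lookup-++ʳ G H i))))

  lincomb-++ : ∀ {m k n} (a : Fin m → Carrier) (b : Fin k → Carrier) (G : Mat F m n) (H : Mat F k n) →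
               lincomb F (a ++ b) (G ++ H) ≈ lincomb F a G +ᵛ lincomb F b H
  lincomb-++ a b G H = ≈-trans (lincomb-split (a ++ b) G H)
    (λ j → cong₂ _+_ (lincomb-congˡ G (lookup-++ˡ a b) j) (lincomb-congˡ H (lookup-++ʳ a b) j))

  lincomb-⊖ : ∀ {m n} (c : Fin m → Carrier) (G H : Mat F m n) →
              lincomb F c (_⊖_ F G H) ≈ lincomb F c G +ᵛ (-ᵛ lincomb F c H)
  lincomb-⊖ c G H j = begin
    ∑ F (λ i → c i * (G i j + - H i j))
      ≡⟨ ∑-cong (λ i → trans (distribˡ (c i) _ _) (cong (c i * G i j +_) (sym (-‿distribʳ-* _ _)))) ⟩
    ∑ F (λ i → c i * G i j + - (c i * H i j))
      ≡⟨ ∑-distrib-+ (λ i → c i * G i j) (λ i → - (c i * H i j)) ⟩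
    lincomb F c G j + ∑ F (λ i → - (c i * H i j))
      ≡⟨ cong (lincomb F c G j +_) (∑-neg (λ i → c i * H i j)) ⟩
    lincomb F c G j + - lincomb F c H j  ∎

  lincomb-injective : ∀ {m n} {G : Mat F m n} → LinIndep F G →
                      ∀ {c c′} → lincomb F c G ≈ lincomb F c′ G → ∀ i → c i ≡ c′ i
  lincomb-injective {G = G} indep {c} {c′} cG≈c′G i = x∙y⁻¹≈ε⇒x≈y _ _ (indep _ [c-c′]G≈0 i)
    where
    [c-c′]G≈0 : lincomb F (λ i → c i + - c′ i) G ≈ 0ᵛ
    [c-c′]G≈0 j = begin
      lincomb F (λ i → c i + - c′ i) G j             ≡⟨ lincomb-+ c _ G j ⟩
      lincomb F c G j + lincomb F (λ i → - c′ i) G j  ≡⟨ cong₂ _+_ (cG≈c′G j) (lincomb-neg c′ G j) ⟩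
      lincomb F c′ G j + - lincomb F c′ G j           ≡⟨ -‿inverseʳ _ ⟩
      0#                                              ∎

  InSpan-resp : ∀ {m n} (G : Mat F m n) {x y} → x ≈ y → InSpan F G x → InSpan F G y
  InSpan-resp G x≈y (c , x≈cG) = c , ≈-trans (≈-sym x≈y) x≈cG

  InSpan-row : ∀ {m n} (G : Mat F m n) i → InSpan F G (G i)
  InSpan-row G i = I i , ≈-sym (lincomb-I i G)

  InSpan-I : ∀ {n} (x : FVec F n) → InSpan F I x
  InSpan-I x = x , lincomb-of-I x

  InSpan-neg : ∀ {m n} (G : Mat F m n) {x} → InSpan F G x → InSpan F G (-ᵛ x)
  InSpan-neg G (c , x≈cG) = (λ i → - c i) , λ j → trans (cong -_ (x≈cG j)) (sym (lincomb-neg c G j))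

  InSpan-lincomb : ∀ {m p n} {G : Mat F m n} (H : Mat F p n) →
                   (∀ i → InSpan F H (G i)) → ∀ c → InSpan F H (lincomb F c G)
  InSpan-lincomb H G⊆H c =
    lincomb F c (proj₁ ∘ G⊆H) , ≈-trans (lincomb-congʳ c (proj₂ ∘ G⊆H)) (lincomb-assoc c (proj₁ ∘ G⊆H) H)

  InSpan-mono : ∀ {m p n} {G : Mat F m n} (H : Mat F p n) →
                (∀ i → InSpan F H (G i)) → ∀ {x} → InSpan F G x → InSpan F H x
  InSpan-mono H G⊆H (c , x≈cG) = InSpan-resp H (≈-sym x≈cG) (InSpan-lincomb H G⊆H c)

  lincomb-neg+≈0 : ∀ {m n} (Z : Mat F m n) {w : FVec F n} {a} →
                   w ≈ lincomb F a Z → lincomb F (λ i → - a i) Z +ᵛ w ≈ 0ᵛ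
  lincomb-neg+≈0 Z {w} {a} w≈aZ j = begin
    lincomb F (λ i → - a i) Z j + w j  ≡⟨ cong (_+ w j) (lincomb-neg a Z j) ⟩
    - lincomb F a Z j + w j            ≡⟨ cong (λ y → - y + w j) (w≈aZ j) ⟨
    - w j + w j                        ≡⟨ -‿inverseˡ (w j) ⟩
    0#                                 ∎

  ↑-elim : ∀ {m n} (P : Fin (m +ℕ n) → Set) → (∀ i → P (i ↑ˡ n)) → (∀ j → P (m ↑ʳ j)) → ∀ i → P i
  ↑-elim {m} {n} P Pˡ Pʳ i = subst P (Fin.join-splitAt m n i) ([_,_] {C = P ∘ join m n} Pˡ Pʳ (splitAt m i))

  ++-rows : ∀ {m k n} (P : FVec F n → Set) {G : Mat F m n} {H : Mat F k n} →
            (∀ i → P (G i)) → (∀ i → P (H i)) → ∀ i → P ((G ++ H) i)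
  ++-rows P {G} {H} PG PH = ↑-elim (P ∘ (G ++ H))
    (λ i → subst P (sym (lookup-++ˡ G H i)) (PG i))
    (λ j → subst P (sym (lookup-++ʳ G H j)) (PH j))

  InSpan-++ˡ : ∀ {m k n} (G : Mat F m n) (H : Mat F k n) {x} → InSpan F G x → InSpan F (G ++ H) x
  InSpan-++ˡ {k = k} G H =
    InSpan-mono (G ++ H) (λ i → subst (InSpan F (G ++ H)) (lookup-++ˡ G H i) (InSpan-row (G ++ H) (i ↑ˡ k)))

  InSpan-++ʳ : ∀ {m k n} (G : Mat F m n) (H : Mat F k n) {x} → InSpan F H x → InSpan F (G ++ H) x
  InSpan-++ʳ {m} G H =
    InSpan-mono (G ++ H) (λ j → subst (InSpan F (G ++ H)) (lookup-++ʳ G H j) (InSpan-row (G ++ H) (m ↑ʳ j)))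

  InSpan-++⁺ : ∀ {m k n} (G : Mat F m n) (H : Mat F k n) {x} a b →
               x ≈ lincomb F a G +ᵛ lincomb F b H → InSpan F (G ++ H) x
  InSpan-++⁺ G H a b x≈aG+bH = a ++ b , ≈-trans x≈aG+bH (≈-sym (lincomb-++ a b G H))

  InSpan-++⁻ : ∀ {m k n} (G : Mat F m n) (H : Mat F k n) {x} → InSpan F (G ++ H) x →
               Σ (Fin m → Carrier) λ a → Σ (Fin k → Carrier) λ b → x ≈ lincomb F a G +ᵛ lincomb F b H
  InSpan-++⁻ G H (c , x≈cGH) = _ , _ , ≈-trans x≈cGH (lincomb-split c G H)

  JointlyIndep : ∀ {m k n} → Mat F m n → Mat F k n → Set
  JointlyIndep Z X =
    ∀ a b → lincomb F a Z +ᵛ lincomb F b X ≈ 0ᵛ → (∀ i → a i ≡ 0#) × (∀ i → b i ≡ 0#)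

  JointlyIndep⇒LinIndep : ∀ {m k n} {Z : Mat F m n} {X : Mat F k n} → JointlyIndep Z X → LinIndep F (Z ++ X)
  JointlyIndep⇒LinIndep {m} {k} {Z = Z} {X} indep c cZX≈0 =
    ↑-elim (λ i → c i ≡ 0#) (proj₁ c≗0) (proj₂ c≗0)
    where
    c≗0 = indep (c ∘ (_↑ˡ k)) (c ∘ (m ↑ʳ_)) (≈-trans (≈-sym (lincomb-split c Z X)) cZX≈0)

  JointlyIndep⇒LinIndepʳ : ∀ {m k n} {Z : Mat F m n} {X : Mat F k n} → JointlyIndep Z X → LinIndep F X
  JointlyIndep⇒LinIndepʳ {Z = Z} {X} indep c cX≈0 = proj₂ (indep (λ _ → 0#) c 0Z+cX≈0)
    where
    0Z+cX≈0 : lincomb F (λ _ → 0#) Z +ᵛ lincomb F c X ≈ 0ᵛ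
    0Z+cX≈0 j = trans (cong (_+ lincomb F c X j) (lincomb-zeroˡ Z j)) (trans (+-identityˡ _) (cX≈0 j))

  JointlyIndep-[] : ∀ {m n} {Z : Mat F m n} → LinIndep F Z → JointlyIndep Z []
  JointlyIndep-[] indep a b aZ+0≈0 = indep a (λ j → trans (sym (+-identityʳ _)) (aZ+0≈0 j)) , λ ()

  LinIndep⇒JointlyIndep-[] : ∀ {k n} {X : Mat F k n} → LinIndep F X → JointlyIndep [] X
  LinIndep⇒JointlyIndep-[] indep a b 0+bX≈0 = (λ ()) , indep b (λ j → trans (sym (+-identityˡ _)) (0+bX≈0 j))

  lincomb-pad : ∀ {r e n} (c : Fin r → Carrier) (G : Mat F (r +ℕ e) n) →
                lincomb F (c ++ (λ _ → 0#)) G ≈ lincomb F c (λ i → G (i ↑ˡ e))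
  lincomb-pad {r} {e} c G j = begin
    lincomb F c′ G j                                                      ≡⟨ ∑-++ {r} {e} (λ i → c′ i * G i j) ⟩
    ∑ F (λ i → c′ (i ↑ˡ e) * G (i ↑ˡ e) j) + ∑ F (λ l → c′ (r ↑ʳ l) * G (r ↑ʳ l) j)
      ≡⟨ cong₂ _+_ (∑-cong (λ i → cong (_* G (i ↑ˡ e) j) (lookup-++ˡ c _ i)))
                   (∑-zero (λ l → trans (cong (_* G (r ↑ʳ l) j) (lookup-++ʳ c _ l)) (zeroˡ _))) ⟩
    lincomb F c (λ i → G (i ↑ˡ e)) j + 0#                                 ≡⟨ +-identityʳ _ ⟩
    lincomb F c (λ i → G (i ↑ˡ e)) j                                      ∎
    where
    c′ = c ++ (λ _ → 0#)

  JointlyIndep-prefix : ∀ {m r s n} {Z : Mat F m n} {X : Mat F s n} → r ≤ s → JointlyIndep Z X →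
                        Σ (Mat F r n) λ T → JointlyIndep Z T × (∀ i → Σ (Fin s) λ j → T i ≡ X j)
  JointlyIndep-prefix {Z = Z} {X} r≤s indep with ℕ.m≤n⇒∃[o]m+o≡n r≤s
  ... | e , refl = (λ i → X (i ↑ˡ e)) , T-indep , (λ i → i ↑ˡ e , refl)
    where
    T-indep : JointlyIndep Z (λ i → X (i ↑ˡ e))
    T-indep a b aZ+bT≈0 =
      proj₁ a,b0≗0 , λ i → trans (sym (lookup-++ˡ b (λ _ → 0#) i)) (proj₂ a,b0≗0 (i ↑ˡ e))
      where
      a,b0≗0 = indep a (b ++ (λ _ → 0#)) λ j →
        trans (cong (lincomb F a Z j +_) (lincomb-pad b X j)) (aZ+bT≈0 j)

  basis-⊆ : ∀ {n t} {P : FVec F n → Set} (P-dim : HasDim F P t) → ∀ i → P (proj₁ P-dim i)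
  basis-⊆ (B , _ , P⇔B) i = Equivalence.from (P⇔B (B i)) (InSpan-row B i)

  HasDim-InSpan : ∀ {m n} {G : Mat F m n} → LinIndep F G → HasDim F (InSpan F G) m
  HasDim-InSpan {G = G} G-indep = G , G-indep , λ x → mk⇔ id id

  HasDim⇒subfamily : ∀ {n t r} {P : FVec F n → Set} → HasDim F P t → r ≤ t →
                     Σ (Mat F r n) λ T → LinIndep F T × (∀ i → P (T i))
  HasDim⇒subfamily {n} {P = P} P-dim@(B , B-indep , _) r≤t
    with JointlyIndep-prefix {Z = [] {A = FVec F n}} r≤t (LinIndep⇒JointlyIndep-[] B-indep)
  ... | T , T-indep , T⊆B =
    T , JointlyIndep⇒LinIndepʳ {Z = [] {A = FVec F n}} T-indep ,
    λ i → subst P (sym (proj₂ (T⊆B i))) (basis-⊆ P-dim (proj₁ (T⊆B i)))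

module FiniteLinearAlgebra (F : Field) {q : ℕ} (Carrier↔Fin : Field.Carrier F ↔ Fin q) where
  open Field F
  open IsCommutativeRing isCommutativeRing
    using (+-assoc; +-comm; +-identityˡ; +-identityʳ; *-assoc; *-comm; *-identityˡ; zeroˡ; distribˡ)
  open LinearAlgebra F
  open import Algebra.Properties.Ring (CommutativeRing.ring commutativeRing)
    using (-‿distribˡ-*; -‿distribʳ-*; +-inverseˡ-unique)
  open import Algebra.Properties.CommutativeSemigroup (CommutativeRing.+-commutativeSemigroup commutativeRing)
    using (x∙yz≈y∙xz)
  open Inverse Carrier↔Fin using (to; from; strictlyInverseˡ; strictlyInverseʳ)

  infix 4 _≟_ _≈?_
  _≟_ : (x y : Carrier) → Dec (x ≡ y)
  _≟_ = via-injection (↔⇒↣ Carrier↔Fin) Fin._≟_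

  _≈?_ : ∀ {n} (x y : FVec F n) → Dec (x ≈ y)
  x ≈? y = Fin.all? (λ j → x j ≟ y j)

  1<q : 1 < q
  1<q = two-distinct (to 0#) (to 1#) (0≢1 ∘ Injection.injective (↔⇒↣ Carrier↔Fin))
    where
    two-distinct : ∀ {r} (a b : Fin r) → a ≢ b → 1 < r
    two-distinct {suc zero}    zero zero a≢b = ⊥-elim (a≢b refl)
    two-distinct {suc (suc r)} _    _    _   = s≤s (s≤s z≤n)

  ^-cancelˡ-≤ : ∀ {m p} → q ^ m ≤ q ^ p → m ≤ p
  ^-cancelˡ-≤ q^m≤q^p = ℕ.≮⇒≥ (λ p<m → ℕ.<⇒≱ (ℕ.^-monoʳ-< q 1<q p<m) q^m≤q^p)

  funToFin-cong : ∀ {m n} {f g : Fin m → Fin n} → (∀ i → f i ≡ g i) → funToFin f ≡ funToFin g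
  funToFin-cong {zero}  f≗g = refl
  funToFin-cong {suc m} f≗g = cong₂ combine (f≗g zero) (funToFin-cong (f≗g ∘ suc))

  encode : ∀ {n} → FVec F n → Fin (q ^ n)
  encode x = funToFin (to ∘ x)

  decode : ∀ {n} → Fin (q ^ n) → FVec F n
  decode c = from ∘ finToFun c

  decode-encode : ∀ {n} (x : FVec F n) → decode (encode x) ≈ x
  decode-encode x j = trans (cong from (Fin.finToFun-funToFin (to ∘ x) j)) (strictlyInverseʳ (x j))

  encode-injective : ∀ {n} {x y : FVec F n} → encode x ≡ encode y → x ≈ y
  encode-injective {x = x} {y} e j =
    trans (sym (decode-encode x j)) (trans (cong (λ c → decode c j) e) (decode-encode y j))

  decode-injective : ∀ {n} {c c′ : Fin (q ^ n)} → decode {n} c ≈ decode c′ → c ≡ c′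
  decode-injective {n} {c} {c′} dc≈dc′ = begin
    c                               ≡⟨ Fin.funToFin-finToFin {n} {q} c ⟨
    funToFin (finToFun {q} {n} c)   ≡⟨ funToFin-cong (λ j → trans (sym (strictlyInverseˡ _))
                                                             (trans (cong to (dc≈dc′ j)) (strictlyInverseˡ _))) ⟩
    funToFin (finToFun {q} {n} c′)  ≡⟨ Fin.funToFin-finToFin {n} {q} c′ ⟩
    c′                              ∎
    where open ≡-Reasoning

  InSpan? : ∀ {m n} (G : Mat F m n) x → Dec (InSpan F G x)
  InSpan? G x with Fin.any? (λ c → x ≈? lincomb F (decode c) G)
  ... | yes (c , x≈cG) = yes (decode c , x≈cG)
  ... | no ∄c = no λ (c , x≈cG) →
    ∄c (encode c , ≈-trans x≈cG (lincomb-congˡ G (λ i → sym (decode-encode c i))))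

  -- By counting: c ↦ (coordinates of c V with respect to W) is an injection Fin (q ^ m) → Fin (q ^ p).
  steinitz : ∀ {m p n} (V : Mat F m n) (W : Mat F p n) → LinIndep F V → (∀ i → InSpan F W (V i)) → m ≤ p
  steinitz {m} {p} V W V-indep V⊆W = ^-cancelˡ-≤ (Fin.injective⇒≤ φ-injective)
    where
    D : Mat F m p
    D = proj₁ ∘ V⊆W
    cV≈[cD]W : ∀ c → lincomb F c V ≈ lincomb F (lincomb F c D) W
    cV≈[cD]W c = ≈-trans (lincomb-congʳ c (proj₂ ∘ V⊆W)) (lincomb-assoc c D W)
    φ : Fin (q ^ m) → Fin (q ^ p)
    φ c = encode (lincomb F (decode c) D)
    φ-injective : ∀ {c c′} → φ c ≡ φ c′ → c ≡ c′
    φ-injective {c} {c′} φc≡φc′ = decode-injective {m} (lincomb-injective V-indep cV≈c′V)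
      where
      cV≈c′V : lincomb F (decode c) V ≈ lincomb F (decode c′) V
      cV≈c′V = ≈-trans (cV≈[cD]W (decode c))
        (≈-trans (lincomb-congˡ W (encode-injective φc≡φc′)) (≈-sym (cV≈[cD]W (decode c′))))

  LinIndep-≤ : ∀ {m n} (V : Mat F m n) → LinIndep F V → m ≤ n
  LinIndep-≤ V V-indep = steinitz V I V-indep (InSpan-I ∘ V)

  HasDim-≤ : ∀ {n r t} {P : FVec F n → Set} → HasDim F P t →
             (V : Mat F r n) → LinIndep F V → (∀ i → P (V i)) → r ≤ t
  HasDim-≤ (B , _ , P⇔B) V V-indep V⊆P = steinitz V B V-indep (λ i → Equivalence.to (P⇔B (V i)) (V⊆P i))

  HasDim-unique : ∀ {n a b} {P : FVec F n → Set} → HasDim F P a → HasDim F P b → a ≡ b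
  HasDim-unique A-dim@(A , A-indep , _) B-dim@(B , B-indep , _) =
    ℕ.≤-antisym (HasDim-≤ B-dim A A-indep (basis-⊆ A-dim)) (HasDim-≤ A-dim B B-indep (basis-⊆ B-dim))

  record DecSubspace {n} (P : FVec F n → Set) : Set where
    field
      ≈-resp : ∀ {x y} → x ≈ y → P x → P y
      closed : ∀ {m} (G : Mat F m n) c → (∀ i → P (G i)) → P (lincomb F c G)
      dec    : ∀ x → Dec (P x)

  open DecSubspace

  InSpan-decSubspace : ∀ {m n} (G : Mat F m n) → DecSubspace (InSpan F G)
  InSpan-decSubspace G .≈-resp   = InSpan-resp G
  InSpan-decSubspace G .closed H c H⊆G = InSpan-lincomb G H⊆G c
  InSpan-decSubspace G .dec    = InSpan? G

  ∩-decSubspace : ∀ {n} {P Q : FVec F n → Set} → DecSubspace P → DecSubspace Q → DecSubspace (λ x → P x × Q x)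
  ∩-decSubspace SP SQ .≈-resp x≈y (Px , Qx) = SP .≈-resp x≈y Px , SQ .≈-resp x≈y Qx
  ∩-decSubspace SP SQ .closed G c G⊆P∩Q = SP .closed G c (proj₁ ∘ G⊆P∩Q) , SQ .closed G c (proj₂ ∘ G⊆P∩Q)
  ∩-decSubspace SP SQ .dec x with SP .dec x | SQ .dec x
  ... | yes Px | yes Qx = yes (Px , Qx)
  ... | no ¬Px | _      = no (¬Px ∘ proj₁)
  ... | yes _  | no ¬Qx = no (¬Qx ∘ proj₂)

  zeroOn : ∀ {k n} → (Fin k → Fin n) → FVec F n → Set
  zeroOn π x = ∀ i → x (π i) ≡ 0#

  zeroOn-decSubspace : ∀ {k n} (π : Fin k → Fin n) → DecSubspace (zeroOn π)
  zeroOn-decSubspace π .≈-resp x≈y x₀ i = trans (sym (x≈y (π i))) (x₀ i)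
  zeroOn-decSubspace π .closed G c G₀ i = lincomb-zeroʳ c (λ l _ → G₀ l i) i
  zeroOn-decSubspace π .dec x = Fin.all? (λ i → x (π i) ≟ 0#)

  spans-or-escapes : ∀ {m n} {P : FVec F n → Set} → DecSubspace P → (G : Mat F m n) → (∀ i → P (G i)) →
                     (∀ x → P x ⇔ InSpan F G x) ⊎ Σ (FVec F n) λ x → P x × ¬ InSpan F G x
  spans-or-escapes {n = n} {P} SP G G⊆P with Fin.any? (λ c → escapes? (decode {n} c))
    where
    escapes? : ∀ x → Dec (P x × ¬ InSpan F G x)
    escapes? x with SP .dec x | InSpan? G x
    ... | yes Px | no x∉G = yes (Px , x∉G)
    ... | yes _  | yes x∈G = no (λ (_ , x∉G) → x∉G x∈G)
    ... | no ¬Px | _      = no (¬Px ∘ proj₁)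
  ... | yes (c , escape) = inj₂ (decode c , escape)
  ... | no ∄c = inj₁ λ x → mk⇔ (P⊆G x) (λ (c , x≈cG) → SP .≈-resp (≈-sym x≈cG) (SP .closed G c G⊆P))
    where
    P⊆G : ∀ x → P x → InSpan F G x
    P⊆G x Px with InSpan? G x
    ... | yes x∈G = x∈G
    ... | no x∉G =
      ⊥-elim (∄c (encode x , SP .≈-resp (≈-sym (decode-encode x)) Px , x∉G ∘ InSpan-resp G (decode-encode x)))

  JointlyIndep-∷ : ∀ {m s n} {Z : Mat F m n} {X : Mat F s n} {x} →
                   ¬ InSpan F (Z ++ X) x → JointlyIndep Z X → JointlyIndep Z (x ∷ X)
  JointlyIndep-∷ {Z = Z} {X} {x} x∉ZX indep a b aZ+b[xX]≈0 with b zero ≟ 0#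
  ... | yes b₀≡0 = proj₁ a,b′≗0 , λ { zero → b₀≡0 ; (suc i) → proj₂ a,b′≗0 i }
    where
    open ≡-Reasoning
    b₀x≡0 : ∀ j → b zero * x j ≡ 0#
    b₀x≡0 j = trans (cong (_* x j) b₀≡0) (zeroˡ (x j))
    a,b′≗0 = indep a (b ∘ suc) λ j → begin
      lincomb F a Z j + lincomb F (b ∘ suc) X j                  ≡⟨ cong (lincomb F a Z j +_) (+-identityˡ _) ⟨
      lincomb F a Z j + (0# + lincomb F (b ∘ suc) X j)
        ≡⟨ cong (λ y → lincomb F a Z j + (y + lincomb F (b ∘ suc) X j)) (b₀x≡0 j) ⟨
      lincomb F a Z j + (b zero * x j + lincomb F (b ∘ suc) X j) ≡⟨ aZ+b[xX]≈0 j ⟩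
      0#                                                         ∎
  ... | no b₀≢0 = ⊥-elim (x∉ZX (InSpan-++⁺ Z X (λ i → - y * a i) (λ i → - y * b (suc i)) x≈))
    where
    open ≡-Reasoning
    y = proj₁ (inverse (b zero) b₀≢0)
    x≈ : x ≈ lincomb F (λ i → - y * a i) Z +ᵛ lincomb F (λ i → - y * b (suc i)) X
    x≈ j = begin
      x j                     ≡⟨ *-identityˡ (x j) ⟨
      1# * x j                ≡⟨ cong (_* x j) (trans (sym (proj₂ (inverse (b zero) b₀≢0))) (*-comm _ _)) ⟩
      (y * b zero) * x j      ≡⟨ *-assoc y (b zero) (x j) ⟩
      y * (b zero * x j)      ≡⟨ cong (y *_) (+-inverseˡ-unique _ _ (trans (x∙yz≈y∙xz _ _ _) (aZ+b[xX]≈0 j))) ⟩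
      y * - (A + B)           ≡⟨ -‿distribʳ-* y (A + B) ⟨
      - (y * (A + B))         ≡⟨ -‿distribˡ-* y (A + B) ⟩
      - y * (A + B)           ≡⟨ distribˡ (- y) A B ⟩
      - y * A + - y * B       ≡⟨ cong₂ _+_ (lincomb-* (- y) a Z j) (lincomb-* (- y) (b ∘ suc) X j) ⟨
      lincomb F (λ i → - y * a i) Z j + lincomb F (λ i → - y * b (suc i)) X j ∎
      where
      A = lincomb F a Z j
      B = lincomb F (b ∘ suc) X j

  Extension : ∀ {m n} → (FVec F n → Set) → Mat F m n → Set
  Extension {n = n} P Z = Σ ℕ λ s → Σ (Mat F s n) λ X → JointlyIndep Z X × (∀ x → P x ⇔ InSpan F (Z ++ X) x)

  extend : ∀ {m n} {P : FVec F n → Set} → DecSubspace P →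
           {Z : Mat F m n} → LinIndep F Z → (∀ i → P (Z i)) → Extension P Z
  extend {m} {n} {P} SP {Z} Z-indep Z⊆P = go n [] (JointlyIndep-[] Z-indep) (λ ()) (ℕ.m≤n+m n (m +ℕ 0))
    where
    -- The fuel is never exhausted, as F^n has no n + 1 independent vectors.
    go : ∀ fuel {s} (X : Mat F s n) → JointlyIndep Z X → (∀ i → P (X i)) → n ≤ m +ℕ s +ℕ fuel → Extension P Z
    go fuel X indep X⊆P n≤m+s+fuel with spans-or-escapes SP (Z ++ X) (++-rows P Z⊆P X⊆P)
    ... | inj₁ P⇔ZX = _ , X , indep , P⇔ZX
    go zero {s} X indep X⊆P n≤m+s+0 | inj₂ (x , _ , x∉ZX) = ⊥-elim (ℕ.n≮n (m +ℕ s) (begin-strict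
      m +ℕ s       <⟨ ℕ.+-monoʳ-< m (ℕ.n<1+n s) ⟩
      m +ℕ suc s   ≤⟨ LinIndep-≤ (Z ++ (x ∷ X)) (JointlyIndep⇒LinIndep (JointlyIndep-∷ x∉ZX indep)) ⟩
      n            ≤⟨ n≤m+s+0 ⟩
      m +ℕ s +ℕ 0  ≤⟨ ℕ.≤-reflexive (ℕ.+-identityʳ (m +ℕ s)) ⟩
      m +ℕ s       ∎))
      where open ℕ.≤-Reasoning
    go (suc fuel) {s} X indep X⊆P n≤m+s+1+fuel | inj₂ (x , Px , x∉ZX) =
      go fuel (x ∷ X) (JointlyIndep-∷ x∉ZX indep) (λ { zero → Px ; (suc i) → X⊆P i })
         (ℕ.≤-trans n≤m+s+1+fuel (ℕ.≤-reflexive (shift m s fuel)))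
      where
      shift : ∀ m s f → m +ℕ s +ℕ suc f ≡ m +ℕ suc s +ℕ f
      shift = solve-∀

  basis : ∀ {n} {P : FVec F n → Set} → DecSubspace P → Σ ℕ (HasDim F P)
  basis {n} SP with extend SP {[] {A = FVec F n}} (λ _ _ ()) (λ ())
  ... | s , X , []X-indep , P⇔X = s , X , JointlyIndep⇒LinIndepʳ {Z = [] {A = FVec F n}} []X-indep , P⇔X

  -- In a relation a Z + b X + d Y = 0 the vector d Y lies in U = span (Z ++ X) and in W ∋ Y,
  -- hence in span Z, so it vanishes by the independence of Z ++ Y.
  JointlyIndep-++ : ∀ {k k′ t sx sy n} {G : Mat F k n} {H : Mat F k′ n}
                      {Z : Mat F t n} {X : Mat F sx n} {Y : Mat F sy n} →
                    (∀ x → (InSpan F G x × InSpan F H x) ⇔ InSpan F Z x) →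
                    (∀ x → InSpan F G x ⇔ InSpan F (Z ++ X) x) → (∀ i → InSpan F H (Y i)) →
                    JointlyIndep Z X → JointlyIndep Z Y → JointlyIndep Z (X ++ Y)
  JointlyIndep-++ {sx = sx} {sy} {G = G} {H} {Z} {X} {Y} ∩⇔Z G⇔ZX Y⊆H ZX-indep ZY-indep a c aZ+c[XY]≈0 =
    proj₁ a,b≗0 , ↑-elim (λ i → c i ≡ 0#) (proj₂ a,b≗0) (proj₂ a′,d≗0)
    where
    open ≡-Reasoning
    b = c ∘ (_↑ˡ sy)
    d = c ∘ (sx ↑ʳ_)
    w = lincomb F d Y
    aZ+[bX+w]≈0 : lincomb F a Z +ᵛ (lincomb F b X +ᵛ w) ≈ 0ᵛ
    aZ+[bX+w]≈0 j = trans (cong (lincomb F a Z j +_) (sym (lincomb-split c X Y j))) (aZ+c[XY]≈0 j)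
    w≈-[aZ+bX] : w ≈ -ᵛ (lincomb F a Z +ᵛ lincomb F b X)
    w≈-[aZ+bX] j = +-inverseˡ-unique (w j) _ (trans (+-comm (w j) _) (trans (+-assoc _ _ _) (aZ+[bX+w]≈0 j)))
    w∈G : InSpan F G w
    w∈G = InSpan-resp G (≈-sym w≈-[aZ+bX]) (InSpan-neg G (Equivalence.from (G⇔ZX _) (InSpan-++⁺ Z X a b ≈-refl)))
    w∈Z : InSpan F Z w
    w∈Z = Equivalence.to (∩⇔Z w) (w∈G , InSpan-lincomb H Y⊆H d)
    a′ = proj₁ w∈Z
    a′,d≗0 = ZY-indep (λ i → - a′ i) d (lincomb-neg+≈0 Z (proj₂ w∈Z))
    w≈0 : w ≈ 0ᵛ
    w≈0 j = trans (lincomb-congˡ Y (proj₂ a′,d≗0) j) (lincomb-zeroˡ Y j)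
    a,b≗0 = ZX-indep a b λ j → begin
      lincomb F a Z j + lincomb F b X j          ≡⟨ +-identityʳ _ ⟨
      lincomb F a Z j + lincomb F b X j + 0#     ≡⟨ cong (lincomb F a Z j + lincomb F b X j +_) (w≈0 j) ⟨
      lincomb F a Z j + lincomb F b X j + w j    ≡⟨ +-assoc _ _ _ ⟩
      lincomb F a Z j + (lincomb F b X j + w j)  ≡⟨ aZ+[bX+w]≈0 j ⟩
      0#                                         ∎

  InSpan-++-⇔ : ∀ {k k′ t sx sy n} {G : Mat F k n} {H : Mat F k′ n}
                  {Z : Mat F t n} {X : Mat F sx n} {Y : Mat F sy n} →
                (∀ x → InSpan F G x ⇔ InSpan F (Z ++ X) x) → (∀ x → InSpan F H x ⇔ InSpan F (Z ++ Y) x) →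
                ∀ x → InSpan F (G ++ H) x ⇔ InSpan F (Z ++ (X ++ Y)) x
  InSpan-++-⇔ {G = G} {H} {Z} {X} {Y} G⇔ZX H⇔ZY x =
    mk⇔ (InSpan-mono B (++-rows (InSpan F B) G⊆B H⊆B)) (InSpan-mono (G ++ H) B⊆GH)
    where
    B = Z ++ (X ++ Y)
    Z⊆B : ∀ i → InSpan F B (Z i)
    Z⊆B i = InSpan-++ˡ Z (X ++ Y) (InSpan-row Z i)
    X⊆B : ∀ i → InSpan F B (X i)
    X⊆B i = InSpan-++ʳ Z (X ++ Y) (InSpan-++ˡ X Y (InSpan-row X i))
    Y⊆B : ∀ i → InSpan F B (Y i)
    Y⊆B i = InSpan-++ʳ Z (X ++ Y) (InSpan-++ʳ X Y (InSpan-row Y i))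
    G⊆B : ∀ i → InSpan F B (G i)
    G⊆B i = InSpan-mono B (++-rows (InSpan F B) Z⊆B X⊆B) (Equivalence.to (G⇔ZX (G i)) (InSpan-row G i))
    H⊆B : ∀ i → InSpan F B (H i)
    H⊆B i = InSpan-mono B (++-rows (InSpan F B) Z⊆B Y⊆B) (Equivalence.to (H⇔ZY (H i)) (InSpan-row H i))
    B⊆GH : ∀ i → InSpan F (G ++ H) (B i)
    B⊆GH = ++-rows (InSpan F (G ++ H))
      (λ i → InSpan-++ˡ G H (Equivalence.from (G⇔ZX (Z i)) (InSpan-++ˡ Z X (InSpan-row Z i))))
      (++-rows (InSpan F (G ++ H))
        (λ i → InSpan-++ˡ G H (Equivalence.from (G⇔ZX (X i)) (InSpan-++ʳ Z X (InSpan-row X i))))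
        (λ i → InSpan-++ʳ G H (Equivalence.from (H⇔ZY (Y i)) (InSpan-++ʳ Z Y (InSpan-row Y i)))))

  -- Extend a basis Z of U ∩ W to bases Z ++ X of U and Z ++ Y of W; then Z ++ X ++ Y is a basis of U + W.
  grassmann : ∀ {k k′ n s t} {G : Mat F k n} {H : Mat F k′ n} → LinIndep F G → LinIndep F H →
              HasDim F (InSpan F (G ++ H)) s → HasDim F (λ x → InSpan F G x × InSpan F H x) t →
              s +ℕ t ≡ k +ℕ k′
  grassmann {k} {k′} {s = s} {t} {G} {H} G-indep H-indep GH-dim ∩-dim@(Z , Z-indep , ∩⇔Z)
    with extend (InSpan-decSubspace G) Z-indep (proj₁ ∘ basis-⊆ ∩-dim)
       | extend (InSpan-decSubspace H) Z-indep (proj₂ ∘ basis-⊆ ∩-dim)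
  ... | sx , X , ZX-indep , G⇔ZX | sy , Y , ZY-indep , H⇔ZY = begin
    s +ℕ t                  ≡⟨ cong (_+ℕ t) s≡t+sx+sy ⟩
    t +ℕ (sx +ℕ sy) +ℕ t    ≡⟨ regroup t sx sy ⟩
    (t +ℕ sx) +ℕ (t +ℕ sy)  ≡⟨ cong₂ _+ℕ_ t+sx≡k t+sy≡k′ ⟩
    k +ℕ k′                 ∎
    where
    open ≡-Reasoning
    regroup : ∀ t a b → t +ℕ (a +ℕ b) +ℕ t ≡ (t +ℕ a) +ℕ (t +ℕ b)
    regroup = solve-∀
    t+sx≡k : t +ℕ sx ≡ k
    t+sx≡k = HasDim-unique (Z ++ X , JointlyIndep⇒LinIndep ZX-indep , G⇔ZX) (HasDim-InSpan G-indep)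
    t+sy≡k′ : t +ℕ sy ≡ k′
    t+sy≡k′ = HasDim-unique (Z ++ Y , JointlyIndep⇒LinIndep ZY-indep , H⇔ZY) (HasDim-InSpan H-indep)
    Y⊆H : ∀ i → InSpan F H (Y i)
    Y⊆H i = Equivalence.from (H⇔ZY (Y i)) (InSpan-++ʳ Z Y (InSpan-row Y i))
    ZXY-indep : LinIndep F (Z ++ (X ++ Y))
    ZXY-indep = JointlyIndep⇒LinIndep (JointlyIndep-++ {Z = Z} {X} {Y} ∩⇔Z G⇔ZX Y⊆H ZX-indep ZY-indep)
    s≡t+sx+sy : s ≡ t +ℕ (sx +ℕ sy)
    s≡t+sx+sy = HasDim-unique GH-dim (Z ++ (X ++ Y) , ZXY-indep , InSpan-++-⇔ {Z = Z} {X} {Y} G⇔ZX H⇔ZY)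

  SubspaceDist-exists : ∀ {k k′ n} (G : Mat F k n) (H : Mat F k′ n) → Σ ℕ (SubspaceDist F G H)
  SubspaceDist-exists G H
    with basis (InSpan-decSubspace (G ++ H)) | basis (∩-decSubspace (InSpan-decSubspace G) (InSpan-decSubspace H))
  ... | s , GH-dim | t , ∩-dim@(Z , Z-indep , _) = s ∸ t , s , t , GH-dim , ∩-dim , sym (ℕ.m∸n+n≡m t≤s)
    where
    t≤s : t ≤ s
    t≤s = HasDim-≤ GH-dim Z Z-indep (λ i → InSpan-++ˡ G H (proj₁ (basis-⊆ ∩-dim i)))

  SubspaceDist-formula : ∀ {k k′ n ρ} {G : Mat F k n} {H : Mat F k′ n} → LinIndep F G → LinIndep F H →
                         (d : SubspaceDist F G H ρ) → ρ +ℕ 2 *ℕ proj₁ (proj₂ d) ≡ k +ℕ k′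
  SubspaceDist-formula {k} {k′} {ρ = ρ} G-indep H-indep (s , t , GH-dim , ∩-dim , s≡ρ+t) = begin
    ρ +ℕ 2 *ℕ t  ≡⟨ regroup ρ t ⟩
    ρ +ℕ t +ℕ t  ≡⟨ cong (_+ℕ t) s≡ρ+t ⟨
    s +ℕ t       ≡⟨ grassmann G-indep H-indep GH-dim ∩-dim ⟩
    k +ℕ k′      ∎
    where
    open ≡-Reasoning
    regroup : ∀ ρ t → ρ +ℕ 2 *ℕ t ≡ ρ +ℕ t +ℕ t
    regroup = solve-∀

  -- Extend X to a basis X ++ W of F^k; the rows of D then lie in the span of the rows of W D.
  rank+nullity≤ : ∀ {r k n ρ} (X : Mat F r k) → LinIndep F X → (D : Mat F k n) →
                  (∀ l → lincomb F (X l) D ≈ 0ᵛ) → HasRank F D ρ → ρ +ℕ r ≤ k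
  rank+nullity≤ {r} {k} {n} {ρ} X X-indep D XD≈0 D-rank@(B , B-indep , _)
    with extend (InSpan-decSubspace I) X-indep (InSpan-I ∘ X)
  ... | s , W , XW-indep , I⇔XW =
    ℕ.≤-trans (ℕ.+-monoˡ-≤ r ρ≤s) (ℕ.≤-reflexive (trans (ℕ.+-comm s r) r+s≡k))
    where
    open ≡-Reasoning
    r+s≡k : r +ℕ s ≡ k
    r+s≡k = HasDim-unique (X ++ W , JointlyIndep⇒LinIndep XW-indep , I⇔XW) (HasDim-InSpan I-indep)
    WD : Mat F s n
    WD l = lincomb F (W l) D
    D⊆WD : ∀ a → InSpan F WD (D a)
    D⊆WD a with InSpan-++⁻ X W (Equivalence.to (I⇔XW (I a)) (InSpan-I (I a)))
    ... | c₁ , c₂ , Ia≈c₁X+c₂W = c₂ , λ j → begin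
      D a j                                                      ≡⟨ lincomb-I a D j ⟨
      lincomb F (I a) D j                                        ≡⟨ lincomb-congˡ D Ia≈c₁X+c₂W j ⟩
      lincomb F (λ i → lincomb F c₁ X i + lincomb F c₂ W i) D j
        ≡⟨ lincomb-+ (lincomb F c₁ X) (lincomb F c₂ W) D j ⟩
      lincomb F (lincomb F c₁ X) D j + lincomb F (lincomb F c₂ W) D j
        ≡⟨ cong₂ _+_ (lincomb-assoc c₁ X D j) (lincomb-assoc c₂ W D j) ⟨
      lincomb F c₁ (λ l → lincomb F (X l) D) j + lincomb F c₂ WD j
        ≡⟨ cong (_+ lincomb F c₂ WD j) (lincomb-zeroʳ c₁ XD≈0 j) ⟩
      0# + lincomb F c₂ WD j                                     ≡⟨ +-identityˡ _ ⟩
      lincomb F c₂ WD j                                          ∎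
    ρ≤s : ρ ≤ s
    ρ≤s = steinitz B WD B-indep (λ i → InSpan-mono WD D⊆WD (basis-⊆ D-rank i))

module Lifting (F : Field) {q : ℕ} (Carrier↔Fin : Field.Carrier F ↔ Fin q) {v k : ℕ} (k≤v : k ≤ v) where
  open Field F
  open IsCommutativeRing isCommutativeRing using (-‿inverseʳ)
  open LinearAlgebra F
  open FiniteLinearAlgebra F Carrier↔Fin
  open Arithmetic
  open Counting

  -- F^v splits into the first k coordinates (L) and the last v ∸ k (R), as in (I_k ∣ A).
  L : Fin k → Fin v
  L i = inject≤ i k≤v

  k+j<v : ∀ (j : Fin (v ∸ k)) → k +ℕ toℕ j < v
  k+j<v j = ℕ.≤-trans (ℕ.+-monoʳ-< k (Fin.toℕ<n j)) (ℕ.≤-reflexive (ℕ.m+[n∸m]≡n k≤v))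

  R : Fin (v ∸ k) → Fin v
  R j = fromℕ< (k+j<v j)

  toℕ-L : ∀ i → toℕ (L i) ≡ toℕ i
  toℕ-L i = Fin.toℕ-inject≤ i k≤v

  toℕ-R : ∀ j → toℕ (R j) ≡ k +ℕ toℕ j
  toℕ-R j = Fin.toℕ-fromℕ< (k+j<v j)

  fromℕ<-L : ∀ i (L<k : toℕ (L i) < k) → fromℕ< L<k ≡ i
  fromℕ<-L i L<k = Fin.toℕ-injective (trans (Fin.toℕ-fromℕ< L<k) (toℕ-L i))

  S : FVec F v → Set
  S = zeroOn L

  S-lincomb : ∀ {r} (P : Mat F r v) c → (∀ l → S (P l)) → S (lincomb F c P)
  S-lincomb = DecSubspace.closed (zeroOn-decSubspace L)

  L-or-R : ∀ c → (∃ λ i → L i ≡ c) ⊎ (∃ λ j → R j ≡ c)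
  L-or-R c with toℕ c ℕ.<? k
  ... | yes c<k = inj₁ (fromℕ< c<k , Fin.toℕ-injective (trans (toℕ-L _) (Fin.toℕ-fromℕ< c<k)))
  ... | no c≮k = inj₂ (fromℕ< c∸k<v∸k , Fin.toℕ-injective (begin
    toℕ (R (fromℕ< c∸k<v∸k))  ≡⟨ toℕ-R _ ⟩
    k +ℕ toℕ (fromℕ< c∸k<v∸k) ≡⟨ cong (k +ℕ_) (Fin.toℕ-fromℕ< c∸k<v∸k) ⟩
    k +ℕ (toℕ c ∸ k)          ≡⟨ ℕ.m+[n∸m]≡n (ℕ.≮⇒≥ c≮k) ⟩
    toℕ c                     ∎))
    where
    open ≡-Reasoning
    c∸k<v∸k : toℕ c ∸ k < v ∸ k
    c∸k<v∸k = ℕ.∸-monoˡ-< (Fin.toℕ<n c) (ℕ.≮⇒≥ c≮k)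

  ≈-by-blocks : ∀ {x y : FVec F v} → (∀ i → x (L i) ≡ y (L i)) → (∀ j → x (R j) ≡ y (R j)) → x ≈ y
  ≈-by-blocks xL≡yL xR≡yR c with L-or-R c
  ... | inj₁ (i , refl) = xL≡yL i
  ... | inj₂ (j , refl) = xR≡yR j

  liftMat-L : ∀ (A : Mat F k (v ∸ k)) r i → liftMat F A r (L i) ≡ I r i
  liftMat-L A r i with toℕ (L i) ℕ.<? k
  ... | no L≮k = ⊥-elim (L≮k (subst (_< k) (sym (toℕ-L i)) (Fin.toℕ<n i)))
  ... | yes L<k with fromℕ< L<k Fin.≟ r
  ...   | yes L≡r = sym (trans (cong (I r) (trans (sym (fromℕ<-L i L<k)) L≡r)) (I-diag r))
  ...   | no L≢r = sym (I-offdiag r i (λ r≡i → L≢r (trans (fromℕ<-L i L<k) (sym r≡i))))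

  liftMat-R : ∀ (A : Mat F k (v ∸ k)) r j → liftMat F A r (R j) ≡ A r j
  liftMat-R A r j with toℕ (R j) ℕ.<? k
  ... | yes R<k = ⊥-elim (ℕ.<⇒≱ R<k (subst (k ≤_) (sym (toℕ-R j)) (ℕ.m≤m+n k (toℕ j))))
  ... | no _ = cong (A r) (Fin.toℕ-injective
    (trans (Fin.toℕ-fromℕ< _) (trans (cong (_∸ k) (toℕ-R j)) (ℕ.m+n∸m≡n k (toℕ j)))))

  InSpan-liftMat : ∀ (A : Mat F k (v ∸ k)) (x : FVec F v) →
                   (∀ j → x (R j) ≡ lincomb F (x ∘ L) A j) → InSpan F (liftMat F A) x
  InSpan-liftMat A x xR≡[xL]A = x ∘ L , ≈-by-blocks
    (λ i → trans (lincomb-of-I (x ∘ L) i) (∑-cong (λ r → cong (x (L r) *_) (sym (liftMat-L A r i)))))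
    (λ j → trans (xR≡[xL]A j) (∑-cong (λ r → cong (x (L r) *_) (sym (liftMat-R A r j)))))

  encodeMat : ∀ {r} → Mat F r (v ∸ k) → Fin (q ^ ((v ∸ k) *ℕ r))
  encodeMat {r} X = cast (ℕ.^-*-assoc q (v ∸ k) r) (funToFin (encode ∘ X))

  encodeMat-injective : ∀ {r} {X Y : Mat F r (v ∸ k)} → encodeMat X ≡ encodeMat Y → ∀ l → X l ≈ Y l
  encodeMat-injective {r} {X} {Y} e l = encode-injective (begin
    encode (X l)                        ≡⟨ Fin.finToFun-funToFin (encode ∘ X) l ⟨
    finToFun (funToFin (encode ∘ X)) l
      ≡⟨ cong (λ c → finToFun c l) (cast-injective (ℕ.^-*-assoc q (v ∸ k) r) e) ⟩
    finToFun (funToFin (encode ∘ Y)) l  ≡⟨ Fin.finToFun-funToFin (encode ∘ Y) l ⟩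
    encode (Y l)                        ∎)
    where open ≡-Reasoning

  -- The q^((v-k)(k-δ+1)) matrices T_L · A (A in the MRD code) are pairwise distinct, since otherwise
  -- T_L would lie in the left kernel of a difference of rank ≥ δ; so they exhaust all such matrices.
  mrd-covers : ∀ {δ} → δ ≤ k → (Ms : Fin (q ^ ((v ∸ k) *ℕ (k ∸ δ +ℕ 1))) → Mat F k (v ∸ k)) →
               (∀ i j → i ≢ j → ∀ ρ → HasRank F (_⊖_ F (Ms i) (Ms j)) ρ → δ ≤ ρ) →
               (T : Mat F (k ∸ δ +ℕ 1) v) → LinIndep F (λ l i → T l (L i)) →
               ∃ λ i → ∀ l → InSpan F (liftMat F (Ms i)) (T l)
  mrd-covers {δ} δ≤k Ms Ms-distance T T_L-indep =
    i₀ , λ l → InSpan-liftMat (Ms i₀) (T l) (λ j → sym (encodeMat-injective ψi₀≡Y l j))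
    where
    T_L : Mat F (k ∸ δ +ℕ 1) k
    T_L l i = T l (L i)
    ψ : Fin (q ^ ((v ∸ k) *ℕ (k ∸ δ +ℕ 1))) → Fin (q ^ ((v ∸ k) *ℕ (k ∸ δ +ℕ 1)))
    ψ i = encodeMat (λ l → lincomb F (T_L l) (Ms i))
    ψ-injective : ∀ {i i′} → ψ i ≡ ψ i′ → i ≡ i′
    ψ-injective {i} {i′} ψi≡ψi′ with i Fin.≟ i′
    ... | yes i≡i′ = i≡i′
    ... | no i≢i′ = ⊥-elim (δ+[k∸δ+1]≰k δ≤k (begin
      δ +ℕ (k ∸ δ +ℕ 1)  ≤⟨ ℕ.+-monoˡ-≤ _ (Ms-distance i i′ i≢i′ ρ D-rank) ⟩
      ρ +ℕ (k ∸ δ +ℕ 1)  ≤⟨ rank+nullity≤ T_L T_L-indep D T_LD≈0 D-rank ⟩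
      k                  ∎))
      where
      open ℕ.≤-Reasoning
      D = _⊖_ F (Ms i) (Ms i′)
      ρ = proj₁ (basis (InSpan-decSubspace D))
      D-rank = proj₂ (basis (InSpan-decSubspace D))
      T_LD≈0 : ∀ l → lincomb F (T_L l) D ≈ 0ᵛ
      T_LD≈0 l j = trans (lincomb-⊖ (T_L l) (Ms i) (Ms i′) j)
        (trans (cong (_+ - lincomb F (T_L l) (Ms i′) j) (encodeMat-injective ψi≡ψi′ l j)) (-‿inverseʳ _))
    i₀ = proj₁ (injective⇒surjective ψ-injective (encodeMat (λ l j → T l (R j))))
    ψi₀≡Y = proj₂ (injective⇒surjective ψ-injective (encodeMat (λ l j → T l (R j))))

  LinIndep-R : ∀ {r} {P : Mat F r v} → (∀ l → S (P l)) → LinIndep F P → LinIndep F (λ l j → P l (R j))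
  LinIndep-R {P = P} P⊆S P-indep c cPᴿ≈0 =
    P-indep c (≈-by-blocks (S-lincomb P c P⊆S) cPᴿ≈0)

  JointlyIndep⇒LinIndep-L : ∀ {m t r} {G : Mat F m v} {Z : Mat F t v} {T : Mat F r v} →
                            (∀ x → (InSpan F G x × S x) ⇔ InSpan F Z x) → (∀ l → InSpan F G (T l)) →
                            JointlyIndep Z T → LinIndep F (λ l i → T l (L i))
  JointlyIndep⇒LinIndep-L {G = G} {Z} {T} G∩S⇔Z T⊆G ZT-indep c cTᴸ≈0 =
    proj₂ (ZT-indep (λ i → - proj₁ w∈Z i) c (lincomb-neg+≈0 Z (proj₂ w∈Z)))
    where
    w∈Z : InSpan F Z (lincomb F c T)
    w∈Z = Equivalence.to (G∩S⇔Z (lincomb F c T)) (InSpan-lincomb G T⊆G c , cTᴸ≈0)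

module LiftedMRDBound (F : Field) {q : ℕ} (Carrier↔Fin : Field.Carrier F ↔ Fin q)
                      {v k δ M : ℕ} (k≤v : k ≤ v) (δ≤k : δ ≤ k)
                      (Cs : Fin M → Mat F k v) (Cs-cdc : IsCDC F v (2 *ℕ δ) k M Cs)
                      (lifted : ContainsLiftedMRD F q v δ k M Cs) where
  open Field F
  open LinearAlgebra F
  open FiniteLinearAlgebra F Carrier↔Fin
  open Lifting F Carrier↔Fin k≤v
  open Arithmetic
  open Counting

  intersection-bound : ∀ {j j′ t} → j ≢ j′ → (Z : Mat F t v) → LinIndep F Z →
                       (∀ l → InSpan F (Cs j) (Z l) × InSpan F (Cs j′) (Z l)) → δ +ℕ t ≤ k
  intersection-bound {j} {j′} {t} j≢j′ Z Z-indep Z⊆∩ = ℕ.≤-trans (ℕ.+-monoʳ-≤ δ t≤t₀) δ+t₀≤k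
    where
    ρ : ℕ
    ρ = proj₁ (SubspaceDist-exists (Cs j) (Cs j′))
    d : SubspaceDist F (Cs j) (Cs j′) ρ
    d = proj₂ (SubspaceDist-exists (Cs j) (Cs j′))
    t₀ : ℕ
    t₀ = proj₁ (proj₂ d)
    t≤t₀ : t ≤ t₀
    t≤t₀ = HasDim-≤ (proj₁ (proj₂ (proj₂ (proj₂ d)))) Z Z-indep Z⊆∩
    δ+t₀≤k : δ +ℕ t₀ ≤ k
    δ+t₀≤k = distance≥2δ⇒δ+t≤k {ρ} {t₀} (SubspaceDist-formula (proj₁ Cs-cdc j) (proj₁ Cs-cdc j′) d)
                                          (proj₂ Cs-cdc j j′ j≢j′ ρ d)

  Ms : Fin (q ^ ((v ∸ k) *ℕ (k ∸ δ +ℕ 1))) → Mat F k (v ∸ k)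
  Ms = proj₁ lifted

  Ms-distance : ∀ i j → i ≢ j → ∀ ρ → HasRank F (_⊖_ F (Ms i) (Ms j)) ρ → δ ≤ ρ
  Ms-distance = proj₂ (proj₂ (proj₂ (proj₁ (proj₂ lifted))))

  covering : Fin (q ^ ((v ∸ k) *ℕ (k ∸ δ +ℕ 1))) → Fin M
  covering i = proj₁ (proj₂ (proj₂ lifted) i)

  lift⊆covering : ∀ i {x} → InSpan F (liftMat F (Ms i)) x → InSpan F (Cs (covering i)) x
  lift⊆covering i {x} = Equivalence.to (proj₂ (proj₂ (proj₂ lifted) i) x)

  Uncovered : Fin M → Set
  Uncovered j = ∀ i → covering i ≢ j

  δ≤dim[Cs∩S] : ∀ {j t} → Uncovered j → HasDim F (λ x → InSpan F (Cs j) x × S x) t → δ ≤ t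
  δ≤dim[Cs∩S] {j} {t} j-uncovered ∩S-dim@(Z , Z-indep , ∩S⇔Z)
    with extend (InSpan-decSubspace (Cs j)) Z-indep (proj₁ ∘ basis-⊆ ∩S-dim)
  ... | s , X , ZX-indep , Cj⇔ZX = ℕ.≮⇒≥ t≮δ
    where
    t+s≡k : t +ℕ s ≡ k
    t+s≡k =
      HasDim-unique (Z ++ X , JointlyIndep⇒LinIndep ZX-indep , Cj⇔ZX) (HasDim-InSpan (proj₁ Cs-cdc j))
    X⊆Cj : ∀ i → InSpan F (Cs j) (X i)
    X⊆Cj i = Equivalence.from (Cj⇔ZX (X i)) (InSpan-++ʳ Z X (InSpan-row X i))
    t≮δ : ¬ t < δ
    t≮δ t<δ with JointlyIndep-prefix (m+n≡k⇒k∸δ+1≤n t+s≡k t<δ δ≤k) ZX-indep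
    ... | T , ZT-indep , T⊆X = δ+[k∸δ+1]≰k δ≤k
      (intersection-bound (j-uncovered i) T (JointlyIndep⇒LinIndepʳ ZT-indep)
        (λ l → lift⊆covering i (T⊆lift l) , T⊆Cj l))
      where
      T⊆Cj : ∀ l → InSpan F (Cs j) (T l)
      T⊆Cj l = subst (InSpan F (Cs j)) (sym (proj₂ (T⊆X l))) (X⊆Cj (proj₁ (T⊆X l)))
      cover = mrd-covers δ≤k Ms Ms-distance T (JointlyIndep⇒LinIndep-L ∩S⇔Z T⊆Cj ZT-indep)
      i = proj₁ cover
      T⊆lift = proj₂ cover

  -- Opaque: only the specification is needed, and unfolding the proofs inside makes
  -- conversion checking blow up.
  opaque
    δ-subspace-in-S : ∀ j → Uncovered j →
                      Σ (Mat F δ v) λ P → LinIndep F P × (∀ l → InSpan F (Cs j) (P l) × S (P l))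
    δ-subspace-in-S j j-uncovered = HasDim⇒subfamily (proj₂ Cs∩S) (δ≤dim[Cs∩S] j-uncovered (proj₂ Cs∩S))
      where
      Cs∩S : Σ ℕ (HasDim F (λ x → InSpan F (Cs j) x × S x))
      Cs∩S = basis (∩-decSubspace (InSpan-decSubspace (Cs j)) (zeroOn-decSubspace L))

  uncovered : Enumeration Uncovered
  uncovered = enumerate (λ j → Fin.all? (λ i → ¬? (covering i Fin.≟ j)))
  open Enumeration uncovered

  P : Fin size → Mat F δ v
  P l = proj₁ (δ-subspace-in-S (elem l) (elem-∈ l))

  P⊆Cs : ∀ l i → InSpan F (Cs (elem l)) (P l i)
  P⊆Cs l = proj₁ ∘ proj₂ (proj₂ (δ-subspace-in-S (elem l) (elem-∈ l)))

  P⊆S : ∀ l i → S (P l i)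
  P⊆S l = proj₂ ∘ proj₂ (proj₂ (δ-subspace-in-S (elem l) (elem-∈ l)))

  Pᴿ : Fin size → Mat F δ (v ∸ k)
  Pᴿ l i j = P l i (R j)

  Pᴿ-indep : ∀ l → LinIndep F (Pᴿ l)
  Pᴿ-indep l = LinIndep-R (P⊆S l) (proj₁ (proj₂ (δ-subspace-in-S (elem l) (elem-∈ l))))

  -- A basis of Pᴿ l ∩ Pᴿ l′ lifts, by the same coefficients, into both P l and P l′.
  Pᴿ-distance : ∀ l l′ → l ≢ l′ → ∀ ρ → SubspaceDist F (Pᴿ l) (Pᴿ l′) ρ → 2 *ℕ (2 *ℕ δ ∸ k) ≤ ρ
  Pᴿ-distance l l′ l≢l′ ρ d@(_ , t , _ , ∩-dim@(Z , Z-indep , _) , _) =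
    δ+t≤k⇒2[2δ∸k]≤ρ {ρ} {t} {k} {δ} (SubspaceDist-formula (Pᴿ-indep l) (Pᴿ-indep l′) d)
                    (intersection-bound (l≢l′ ∘ elem-injective) U U-indep U⊆∩)
    where
    a a′ : Fin t → Fin δ → Carrier
    a i = proj₁ (proj₁ (basis-⊆ ∩-dim i))
    a′ i = proj₁ (proj₂ (basis-⊆ ∩-dim i))
    U U′ : Mat F t v
    U i = lincomb F (a i) (P l)
    U′ i = lincomb F (a′ i) (P l′)
    U-indep : LinIndep F U
    U-indep c cU≈0 =
      Z-indep c (λ j → trans (lincomb-congʳ c (λ i → proj₂ (proj₁ (basis-⊆ ∩-dim i))) j) (cU≈0 (R j)))
    U≈U′ : ∀ i → U i ≈ U′ i
    U≈U′ i = ≈-by-blocks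
      (λ i′ → trans (S-lincomb (P l) (a i) (P⊆S l) i′) (sym (S-lincomb (P l′) (a′ i) (P⊆S l′) i′)))
      (λ j → trans (sym (proj₂ (proj₁ (basis-⊆ ∩-dim i)) j)) (proj₂ (proj₂ (basis-⊆ ∩-dim i)) j))
    U⊆∩ : ∀ i → InSpan F (Cs (elem l)) (U i) × InSpan F (Cs (elem l′)) (U i)
    U⊆∩ i = InSpan-lincomb (Cs (elem l)) (P⊆Cs l) (a i) ,
            InSpan-resp (Cs (elem l′)) (≈-sym (U≈U′ i)) (InSpan-lincomb (Cs (elem l′)) (P⊆Cs l′) (a′ i))

  projected-code : CDC F (v ∸ k) (2 *ℕ (2 *ℕ δ ∸ k)) δ size
  projected-code = Pᴿ , Pᴿ-indep , Pᴿ-distance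

  lifted-MRD-bound : ∀ a → IsMaxCDCSize F (v ∸ k) (2 *ℕ (2 *ℕ δ ∸ k)) δ a →
                     M ≤ q ^ ((v ∸ k) *ℕ (k ∸ δ +ℕ 1)) +ℕ a
  lifted-MRD-bound a (_ , maximal) =
    ℕ.≤-trans (≤-image+complement covering uncovered) (ℕ.+-monoʳ-≤ _ (maximal size projected-code))

open import Data.Nat using (_+_; _*_)

proposition2 : (q : ℕ) → IsPrimePower q →
    (F : Field) → (Field.Carrier F ↔ Fin q) →
    (v d k : ℕ) → 2 ∣ d → 2 ≤ d / 2 → d / 2 ≤ k → 2 * k ≤ v → k < d →
    (M : ℕ) → (C : CDC F v d k M) →
    ContainsLiftedMRD F q v (d / 2) k M (proj₁ C) →
    (a : ℕ) → IsMaxCDCSize F (v ∸ k) (2 * (d ∸ k)) (d / 2) a →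
    M ≤ q ^ ((v ∸ k) * (k ∸ d / 2 + 1)) + a
proposition2 q _ F Carrier↔Fin v d k 2∣d _ δ≤k 2k≤v _ M (Cs , Cs-cdc) lifted a maxA =
  LiftedMRDBound.lifted-MRD-bound F Carrier↔Fin k≤v δ≤k Cs
    (subst (λ d′ → IsCDC F v d′ k M Cs) d≡2δ Cs-cdc) lifted a
    (subst (λ d′ → IsMaxCDCSize F (v ∸ k) (2 * (d′ ∸ k)) (d / 2) a) d≡2δ maxA)
  where
  k≤v : k ≤ v
  k≤v = ℕ.≤-trans (ℕ.m≤m+n k (k + 0)) 2k≤v
  d≡2δ : d ≡ 2 * (d / 2)
  d≡2δ = sym (m*[n/m]≡n 2∣d)
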